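{- Let $r\geq 5$ and $n=3r-2$. If $S$ is a maximum $2$-packing of the Kneser graph $K(n,r)$, then, up to an automorphism of $K(n,r)$, either $$S=\big\{\{1,2\}\cup\{4,\dots,r+1\},\ \{1,3\}\cup\{r+2,\dots,2r-1\},\ \{2,3\}\cup\{2r,\dots,3r-3\}\big\},$$ or $$S=\big\{\{1\}\cup\{2,\dots,r\},\ \{1\}\cup\{r+1,\dots,2r-1\},\ \{1\}\cup\{2r,\dots,3r-2\}\big\}.$$
   Context: For positive integers $n\geq 2r$, the Kneser graph $K(n,r)$ has as vertices the $r$-subsets of $[n]=\{1,\dots,n\}$, two vertices being adjacent iff they are disjoint. For a vertex $v$, $N[v]$ denotes its closed neighbourhood. A $2$-packing of a graph $G$ is a set $S\subseteq V(G)$ such that $N[u]\cap N[v]=\emptyset$ for all distinct $u,v\in S$; a maximum $2$-packing is one of maximum cardinality. -}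

module Defs where

open import Data.Nat using (ℕ; _≤_; _≤ᵇ_; _*_; _∸_; _+_)
open import Data.Bool using (Bool; _∧_; _∨_)
open import Data.Fin using (Fin; toℕ)
open import Data.Fin.Subset using (Subset; ∣_∣; _∩_; Empty)
open import Data.Vec using (tabulate)
open import Data.Product using (Σ; proj₁; _×_)
open import Data.Sum using (_⊎_)
open import Data.List using (List; length; map; _∷_; [])
open import Data.List.Membership.Propositional using (_∈_)
open import Data.List.Relation.Unary.Unique.Propositional using (Unique)
open import Relation.Binary.PropositionalEquality using (_≡_; _≢_)
open import Relation.Nullary using (¬_)
open import Function.Definitions using (Bijective)
open import Function.Bundles using (_⇔_)

-- Vertices of the Kneser graph K(n,r): r-subsets of Fin n
-- (Fin index i stands for the element i+1 of [n] = {1,...,n}).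
Vertex : ℕ → ℕ → Set
Vertex n r = Σ (Subset n) (λ s → ∣ s ∣ ≡ r)

Adj : ∀ {n r} → Vertex n r → Vertex n r → Set
Adj u v = Empty (proj₁ u ∩ proj₁ v)

InClosedNbhd : ∀ {n r} → Vertex n r → Vertex n r → Set
InClosedNbhd w u = (w ≡ u) ⊎ Adj w u

IsTwoPacking : ∀ {n r} → List (Vertex n r) → Set
IsTwoPacking {n} {r} S =
  Unique S ×
  (∀ u v → u ∈ S → v ∈ S → u ≢ v →
     ∀ (w : Vertex n r) → ¬ (InClosedNbhd w u × InClosedNbhd w v))

IsMaxTwoPacking : ∀ {n r} → List (Vertex n r) → Set
IsMaxTwoPacking {n} {r} S =
  IsTwoPacking S × (∀ (T : List (Vertex n r)) → IsTwoPacking T → length T ≤ length S)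

IsAutomorphism : ∀ {n r} → (Vertex n r → Vertex n r) → Set
IsAutomorphism {n} {r} φ =
  Bijective _≡_ _≡_ φ × (∀ (u v : Vertex n r) → Adj u v ⇔ Adj (φ u) (φ v))

SameSet : ∀ {n} → List (Subset n) → List (Subset n) → Set
SameSet {n} xs ys = ∀ (x : Subset n) → x ∈ xs ⇔ x ∈ ys

-- Subset of Fin n given by a Boolean predicate on the 0-based index
fromPred : ∀ n → (ℕ → Bool) → Subset n
fromPred n f = tabulate (λ i → f (toℕ i))

-- 0-based index m lies in [a, b]   (i.e. element m+1 lies in [a+1, b+1])
inR : ℕ → ℕ → ℕ → Bool
inR a b m = (a ≤ᵇ m) ∧ (m ≤ᵇ b)

-- 0-based index m is the element k (1-based)
is : ℕ → ℕ → Bool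
is k m = inR (k ∸ 1) (k ∸ 1) m

-- Elements (1-based) in the interval [a, b]
iv : ℕ → ℕ → ℕ → Bool
iv a b m = inR (a ∸ 1) (b ∸ 1) m

config1 : (r : ℕ) → List (Subset (3 * r ∸ 2))
config1 r =
  fromPred (3 * r ∸ 2) (λ m → is 1 m ∨ is 2 m ∨ iv 4 (r + 1) m) ∷
  fromPred (3 * r ∸ 2) (λ m → is 1 m ∨ is 3 m ∨ iv (r + 2) (2 * r ∸ 1) m) ∷
  fromPred (3 * r ∸ 2) (λ m → is 2 m ∨ is 3 m ∨ iv (2 * r) (3 * r ∸ 3) m) ∷
  []

config2 : (r : ℕ) → List (Subset (3 * r ∸ 2))
config2 r =
  fromPred (3 * r ∸ 2) (λ m → is 1 m ∨ iv 2 r m) ∷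
  fromPred (3 * r ∸ 2) (λ m → is 1 m ∨ iv (r + 1) (2 * r ∸ 1) m) ∷
  fromPred (3 * r ∸ 2) (λ m → is 1 m ∨ iv (2 * r) (3 * r ∸ 2) m) ∷
  []

-- Two distinct vertices of K(n, r) with n = 3r − 2 have disjoint closed neighbourhoods exactly
-- when they share one element: sharing none makes them adjacent, sharing at least two leaves at
-- least r elements outside their union (a common neighbour), and a common neighbour of two sets
-- sharing one element would need 3r − 1 ≤ n elements.  By the Bonferroni inequality
-- ∑ |Aᵢ| ≤ n + ∑ |Aᵢ ∩ Aⱼ|, four r-sets meeting pairwise in one element force 4r ≤ n + 6, which
-- fails for r ≥ 5, while config2 is a 2-packing of size three.  So a maximum 2-packing consists of
-- three r-sets meeting pairwise in one element.  Counting the eight regions of their Venn diagram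
-- leaves two possibilities, according to whether the three sets share a common element, and these
-- are the region sizes of config2 and config1.  A permutation of [n] carrying one Venn colouring
-- onto the other induces the required automorphism.
module Submission where

open import Data.Bool using (Bool; true; false; _∧_; _∨_; if_then_else_; T)
open import Data.Bool.ListAction using (any)
import Data.Bool.Properties as Bool
open import Data.Bool.Properties using (T-≡; ∧-zeroʳ; ∨-identityʳ)
open import Data.Empty using (⊥-elim)
open import Data.Fin using (Fin; zero; suc; toℕ; punchIn)
open import Data.Fin.Permutation as Perm using (Permutation; _⟨$⟩ʳ_; _⟨$⟩ˡ_)
open import Data.Fin.Properties using (toℕ<n)
open import Data.Fin.Subset using (Subset; inside; outside; ∣_∣; _∩_; _∪_; ∁; _⊆_; _∈_; Empty; ⊥)
open import Data.Fin.Subset.Properties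
  using (∣∁p∣≡n∸∣p∣; ∣p∣≤n; ∣⊥∣≡0; Empty-unique; ⊥⊆; out⊆; in⊆in; x∈p∩q⁻; x∈p∪q⁺; x∈∁p⇒x∉p; ∩-idem; ∩-comm)
open import Data.List using (List; []; _∷_; length; map; take)
open import Data.List.Membership.Propositional using () renaming (_∈_ to _∈ₗ_)
open import Data.List.Properties using (map-cong)
open import Data.List.Relation.Unary.All as All using (All; []; _∷_)
open import Data.List.Relation.Unary.AllPairs as AllPairs using (AllPairs; []; _∷_)
open import Data.List.Relation.Unary.AllPairs.Properties using (take⁺)
open import Data.List.Relation.Unary.Any using (here; there)
open import Data.Nat using (ℕ; zero; suc; _+_; _*_; _∸_; _≤_; _<_; z≤n; s≤s; _≤ᵇ_; _<ᵇ_; _≡ᵇ_)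
open import Data.Nat.Combinatorics using (_C_; nC1≡n; nCk+nC[k+1]≡[n+1]C[k+1])
open import Data.Nat.ListAction using (sum)
open import Data.Nat.Properties
open import Algebra.Properties.Semiring.Sum +-*-semiring
  using (∑-distrib-+; sum-cong-≗; sum-replicate-zero; sum-remove; sum-permute; *-distribʳ-sum)
  renaming (sum to ∑)
open import Data.Nat.Tactic.RingSolver using (solve-∀)
open import Data.Product using (Σ; Σ-syntax; proj₁; proj₂; _×_; _,_)
open import Data.Product.Properties using (≡-dec)
open import Data.Sum using (_⊎_; inj₁; inj₂)
open import Data.Vec using ([]; _∷_; lookup; tabulate; here; there)
open import Data.Vec.Properties using (lookup-zipWith; lookup∘tabulate; tabulate∘lookup; tabulate-cong)
open import Defs
open import Function using (_∘_; id)
open import Function.Bundles using (mk⇔; Equivalence)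
open import Function.Consequences.Propositional
  using (inverseᵇ⇒bijective; strictlyInverseˡ⇒inverseˡ; strictlyInverseʳ⇒inverseʳ)
open import Relation.Binary.Definitions using (DecidableEquality; tri<; tri≈; tri>)
open import Relation.Binary.PropositionalEquality
open import Relation.Nullary using (¬_; contradiction; does; yes)
open import Relation.Nullary.Decidable using (dec-true)

bit : Bool → ℕ
bit true = 1
bit false = 0

count : ∀ {n} → (Fin n → Bool) → ℕ
count p = ∑ (λ i → bit (p i))

∑-mono-≤ : ∀ {n} {f g : Fin n → ℕ} → (∀ i → f i ≤ g i) → ∑ f ≤ ∑ g
∑-mono-≤ {zero} _ = z≤n
∑-mono-≤ {suc n} f≤g = +-mono-≤ (f≤g zero) (∑-mono-≤ (f≤g ∘ suc))

∑-const : ∀ n k → ∑ {n} (λ _ → k) ≡ n * k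
∑-const zero k = refl
∑-const (suc n) k = cong (k +_) (∑-const n k)

∑-split : ∀ l k (f : ℕ → ℕ) →
          ∑ {l + k} (λ i → f (toℕ i)) ≡ ∑ {l} (λ i → f (toℕ i)) + ∑ {k} (λ i → f (l + toℕ i))
∑-split zero k f = refl
∑-split (suc l) k f = trans (cong (f 0 +_) (∑-split l k (f ∘ suc))) (sym (+-assoc (f 0) _ _))

∑-sum-comm : ∀ {n} {A : Set} (f : A → Fin n → ℕ) (xs : List A) →
             sum (map (λ x → ∑ (f x)) xs) ≡ ∑ (λ i → sum (map (λ x → f x i) xs))
∑-sum-comm {n} f [] = sym (sum-replicate-zero n)
∑-sum-comm f (x ∷ xs) = trans (cong (∑ (f x) +_) (∑-sum-comm f xs)) (sym (∑-distrib-+ (f x) _))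

+-*-bit : ∀ m l b → m + l * bit b ≡ (if b then m + l else m)
+-*-bit m l true = cong (m +_) (*-identityʳ l)
+-*-bit m l false = trans (cong (m +_) (*-zeroʳ l)) (+-identityʳ m)

count>0⇒∃ : ∀ {n} (p : Fin n → Bool) → 0 < count p → Σ[ i ∈ Fin n ] T (p i)
count>0⇒∃ {suc n} p pos with p zero in eq
... | true = zero , subst T (sym eq) _
... | false = let i , p-i = count>0⇒∃ (p ∘ suc) pos in suc i , p-i

∣p∣≡count : ∀ {n} (p : Subset n) → ∣ p ∣ ≡ count (lookup p)
∣p∣≡count [] = refl
∣p∣≡count (inside ∷ p) = cong suc (∣p∣≡count p)
∣p∣≡count (outside ∷ p) = ∣p∣≡count p

∣p∩q∣≡count : ∀ {n} (p q : Subset n) → ∣ p ∩ q ∣ ≡ count (λ i → lookup p i ∧ lookup q i)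
∣p∩q∣≡count p q = trans (∣p∣≡count (p ∩ q)) (sum-cong-≗ (λ i → cong bit (lookup-zipWith _∧_ i p q)))

∣p∪q∣+∣p∩q∣≡∣p∣+∣q∣ : ∀ {n} (p q : Subset n) → ∣ p ∪ q ∣ + ∣ p ∩ q ∣ ≡ ∣ p ∣ + ∣ q ∣
∣p∪q∣+∣p∩q∣≡∣p∣+∣q∣ [] [] = refl
∣p∪q∣+∣p∩q∣≡∣p∣+∣q∣ (inside ∷ p) (inside ∷ q) =
  cong suc (trans (+-suc _ _) (trans (cong suc (∣p∪q∣+∣p∩q∣≡∣p∣+∣q∣ p q)) (sym (+-suc _ _))))
∣p∪q∣+∣p∩q∣≡∣p∣+∣q∣ (inside ∷ p) (outside ∷ q) = cong suc (∣p∪q∣+∣p∩q∣≡∣p∣+∣q∣ p q)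
∣p∪q∣+∣p∩q∣≡∣p∣+∣q∣ (outside ∷ p) (inside ∷ q) =
  trans (cong suc (∣p∪q∣+∣p∩q∣≡∣p∣+∣q∣ p q)) (sym (+-suc _ _))
∣p∪q∣+∣p∩q∣≡∣p∣+∣q∣ (outside ∷ p) (outside ∷ q) = ∣p∪q∣+∣p∩q∣≡∣p∣+∣q∣ p q

∣∁p∣+∣p∣≡n : ∀ {n} (p : Subset n) → ∣ ∁ p ∣ + ∣ p ∣ ≡ n
∣∁p∣+∣p∣≡n p = trans (cong (_+ ∣ p ∣) (∣∁p∣≡n∸∣p∣ p)) (m∸n+n≡m (∣p∣≤n p))

Empty⇒∣p∣≡0 : ∀ {n} {p : Subset n} → Empty p → ∣ p ∣ ≡ 0
Empty⇒∣p∣≡0 {n} e = trans (cong ∣_∣ (Empty-unique e)) (∣⊥∣≡0 n)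

∣p∣≡0⇒Empty : ∀ {n} (p : Subset n) → ∣ p ∣ ≡ 0 → Empty p
∣p∣≡0⇒Empty [] _ (() , _)
∣p∣≡0⇒Empty (inside ∷ p) ()
∣p∣≡0⇒Empty (outside ∷ p) ∣p∣≡0 (suc x , there x∈p) = ∣p∣≡0⇒Empty p ∣p∣≡0 (x , x∈p)

subset-of-size : ∀ {n} (p : Subset n) k → k ≤ ∣ p ∣ → Σ[ q ∈ Subset n ] q ⊆ p × ∣ q ∣ ≡ k
subset-of-size {n} p zero _ = ⊥ , ⊥⊆ , ∣⊥∣≡0 n
subset-of-size (inside ∷ p) (suc k) (s≤s k≤∣p∣) =
  let q , q⊆p , ∣q∣≡k = subset-of-size p k k≤∣p∣ in inside ∷ q , in⊆in q⊆p , cong suc ∣q∣≡k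
subset-of-size (outside ∷ p) (suc k) k<∣p∣ =
  let q , q⊆p , ∣q∣≡k = subset-of-size p (suc k) k<∣p∣ in outside ∷ q , out⊆ q⊆p , ∣q∣≡k

module _ {n : ℕ} where

  subset-ext : {p q : Subset n} → (∀ i → lookup p i ≡ lookup q i) → p ≡ q
  subset-ext {p} {q} p≗q = trans (sym (tabulate∘lookup p)) (trans (tabulate-cong p≗q) (tabulate∘lookup q))

  permuteSubset : Permutation n n → Subset n → Subset n
  permuteSubset π p = tabulate (λ i → lookup p (π ⟨$⟩ʳ i))

  module _ (π : Permutation n n) where

    lookup-permuteSubset : ∀ p i → lookup (permuteSubset π p) i ≡ lookup p (π ⟨$⟩ʳ i)
    lookup-permuteSubset p = lookup∘tabulate (λ i → lookup p (π ⟨$⟩ʳ i))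

    ∣permuteSubset∣ : ∀ p → ∣ permuteSubset π p ∣ ≡ ∣ p ∣
    ∣permuteSubset∣ p = begin
      ∣ permuteSubset π p ∣                ≡⟨ ∣p∣≡count (permuteSubset π p) ⟩
      count (lookup (permuteSubset π p))   ≡⟨ sum-cong-≗ (cong bit ∘ lookup-permuteSubset p) ⟩
      ∑ (λ i → bit (lookup p (π ⟨$⟩ʳ i)))  ≡⟨ sum-permute (bit ∘ lookup p) π ⟨
      count (lookup p)                     ≡⟨ ∣p∣≡count p ⟨
      ∣ p ∣                                ∎
      where open ≡-Reasoning

    permuteSubset-∩ : ∀ p q → permuteSubset π (p ∩ q) ≡ permuteSubset π p ∩ permuteSubset π q
    permuteSubset-∩ p q = subset-ext λ i → begin
      lookup (permuteSubset π (p ∩ q)) i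
        ≡⟨ lookup-permuteSubset (p ∩ q) i ⟩
      lookup (p ∩ q) (π ⟨$⟩ʳ i)
        ≡⟨ lookup-zipWith _∧_ (π ⟨$⟩ʳ i) p q ⟩
      lookup p (π ⟨$⟩ʳ i) ∧ lookup q (π ⟨$⟩ʳ i)
        ≡⟨ cong₂ _∧_ (lookup-permuteSubset p i) (lookup-permuteSubset q i) ⟨
      lookup (permuteSubset π p) i ∧ lookup (permuteSubset π q) i
        ≡⟨ lookup-zipWith _∧_ i (permuteSubset π p) (permuteSubset π q) ⟨
      lookup (permuteSubset π p ∩ permuteSubset π q) i
        ∎
      where open ≡-Reasoning

  permuteSubset-flip : ∀ π p → permuteSubset (Perm.flip π) (permuteSubset π p) ≡ p
  permuteSubset-flip π p = subset-ext λ i →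
    trans (lookup-permuteSubset (Perm.flip π) (permuteSubset π p) i)
          (trans (lookup-permuteSubset π p (π ⟨$⟩ˡ i)) (cong (lookup p) (Perm.inverseʳ π)))

-- The Bonferroni inequality

trues : List Bool → ℕ
trues bs = sum (map bit bs)

truePairs : List Bool → ℕ
truePairs [] = 0
truePairs (b ∷ bs) = sum (map (λ c → bit (b ∧ c)) bs) + truePairs bs

trues≤1+truePairs : ∀ bs → trues bs ≤ 1 + truePairs bs
trues≤1+truePairs [] = z≤n
trues≤1+truePairs (true ∷ bs) = s≤s (m≤m+n (trues bs) (truePairs bs))
trues≤1+truePairs (false ∷ bs) =
  ≤-trans (trues≤1+truePairs bs) (+-monoʳ-≤ 1 (m≤n+m (truePairs bs) _))

sizeSum : ∀ {n} → List (Subset n) → ℕ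
sizeSum ps = sum (map ∣_∣ ps)

overlapSum : ∀ {n} → List (Subset n) → ℕ
overlapSum [] = 0
overlapSum (p ∷ ps) = sum (map (λ q → ∣ p ∩ q ∣) ps) + overlapSum ps

module _ {n : ℕ} where

  column : List (Subset n) → Fin n → List Bool
  column ps i = map (λ p → lookup p i) ps

  sizeSum≡∑trues : ∀ ps → sizeSum ps ≡ ∑ (λ i → trues (column ps i))
  sizeSum≡∑trues [] = sym (sum-replicate-zero n)
  sizeSum≡∑trues (p ∷ ps) =
    trans (cong₂ _+_ (∣p∣≡count p) (sizeSum≡∑trues ps))
          (sym (∑-distrib-+ (λ i → bit (lookup p i)) (λ i → trues (column ps i))))

  overlapsWith≡∑ : ∀ p qs → sum (map (λ q → ∣ p ∩ q ∣) qs) ≡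
                            ∑ (λ i → sum (map (λ c → bit (lookup p i ∧ c)) (column qs i)))
  overlapsWith≡∑ p [] = sym (sum-replicate-zero n)
  overlapsWith≡∑ p (q ∷ qs) =
    trans (cong₂ _+_ (∣p∩q∣≡count p q) (overlapsWith≡∑ p qs))
          (sym (∑-distrib-+ (λ i → bit (lookup p i ∧ lookup q i))
                            (λ i → sum (map (λ c → bit (lookup p i ∧ c)) (column qs i)))))

  overlapSum≡∑truePairs : ∀ ps → overlapSum ps ≡ ∑ (λ i → truePairs (column ps i))
  overlapSum≡∑truePairs [] = sym (sum-replicate-zero n)
  overlapSum≡∑truePairs (p ∷ ps) =
    trans (cong₂ _+_ (overlapsWith≡∑ p ps) (overlapSum≡∑truePairs ps))
          (sym (∑-distrib-+ (λ i → sum (map (λ c → bit (lookup p i ∧ c)) (column ps i)))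
                            (λ i → truePairs (column ps i))))

  bonferroni : ∀ ps → sizeSum ps ≤ n + overlapSum ps
  bonferroni ps = begin
    sizeSum ps                                   ≡⟨ sizeSum≡∑trues ps ⟩
    ∑ (λ i → trues (column ps i))                ≤⟨ ∑-mono-≤ (λ i → trues≤1+truePairs (column ps i)) ⟩
    ∑ (λ i → 1 + truePairs (column ps i))        ≡⟨ ∑-distrib-+ (λ _ → 1) (λ i → truePairs (column ps i)) ⟩
    ∑ {n} (λ _ → 1) + ∑ (λ i → truePairs (column ps i))
      ≡⟨ cong₂ _+_ (trans (∑-const n 1) (*-identityʳ n)) (sym (overlapSum≡∑truePairs ps)) ⟩
    n + overlapSum ps                            ∎
    where open ≤-Reasoning

-- 2-packings of Kneser graphs

shared : ∀ {n r} → Vertex n r → Vertex n r → ℕ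
shared u v = ∣ proj₁ u ∩ proj₁ v ∣

ClosedNbhdsDisjoint : ∀ {n r} → Vertex n r → Vertex n r → Set
ClosedNbhdsDisjoint {n} {r} u v = ∀ (w : Vertex n r) → ¬ (InClosedNbhd w u × InClosedNbhd w v)

allPairs-map-∈ : ∀ {A : Set} {R Q : A → A → Set} {xs : List A} →
                 (∀ {u v} → u ∈ₗ xs → v ∈ₗ xs → R u v → Q u v) → AllPairs R xs → AllPairs Q xs
allPairs-map-∈ f [] = []
allPairs-map-∈ f (Rx ∷ Rxs) =
  All.tabulate (λ v∈xs → f (here refl) (there v∈xs) (All.lookup Rx v∈xs)) ∷
  allPairs-map-∈ (λ u∈xs v∈xs → f (there u∈xs) (there v∈xs)) Rxs

allPairs-∈ : ∀ {A : Set} {R : A → A → Set} {xs : List A} → (∀ {u v} → R u v → R v u) →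
             AllPairs R xs → ∀ {u v} → u ∈ₗ xs → v ∈ₗ xs → u ≢ v → R u v
allPairs-∈ R-sym (_ ∷ _) (here refl) (here refl) u≢v = contradiction refl u≢v
allPairs-∈ R-sym (Rx ∷ _) (here refl) (there v∈xs) _ = All.lookup Rx v∈xs
allPairs-∈ R-sym (Rx ∷ _) (there u∈xs) (here refl) _ = R-sym (All.lookup Rx u∈xs)
allPairs-∈ R-sym (_ ∷ Rxs) (there u∈xs) (there v∈xs) u≢v = allPairs-∈ R-sym Rxs u∈xs v∈xs u≢v

module _ {n r : ℕ} where

  sizeSum-vertices : (vs : List (Vertex n r)) → sizeSum (map proj₁ vs) ≡ length vs * r
  sizeSum-vertices [] = refl
  sizeSum-vertices ((_ , ∣p∣≡r) ∷ vs) = cong₂ _+_ ∣p∣≡r (sizeSum-vertices vs)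

  shared-self : (u : Vertex n r) → shared u u ≡ r
  shared-self (p , ∣p∣≡r) = trans (cong ∣_∣ (∩-idem p)) ∣p∣≡r

  shared-sym : {u v : Vertex n r} → shared u v ≡ 1 → shared v u ≡ 1
  shared-sym {u} {v} = trans (cong ∣_∣ (∩-comm (proj₁ v) (proj₁ u)))

  common-neighbour : 3 * r ≤ n + 2 → (u v : Vertex n r) → 2 ≤ shared u v →
                     Σ[ w ∈ Vertex n r ] Adj w u × Adj w v
  common-neighbour 3r≤n+2 (U , ∣U∣≡r) (V , ∣V∣≡r) 2≤∣U∩V∣ =
    (W , ∣W∣≡r) , disjoint (λ x∈U → x∈p∪q⁺ (inj₁ x∈U)) , disjoint (λ x∈V → x∈p∪q⁺ (inj₂ x∈V))
    where
    outside-both = ∁ (U ∪ V)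
    r≤∣outside-both∣ : r ≤ ∣ outside-both ∣
    r≤∣outside-both∣ = +-cancelʳ-≤ (r + r) r ∣ outside-both ∣ (begin
      r + (r + r)                                 ≡⟨ cong (λ x → r + (r + x)) (sym (+-identityʳ r)) ⟩
      3 * r                                       ≤⟨ 3r≤n+2 ⟩
      n + 2                                       ≤⟨ +-monoʳ-≤ n 2≤∣U∩V∣ ⟩
      n + ∣ U ∩ V ∣                               ≡⟨ cong (_+ ∣ U ∩ V ∣) (∣∁p∣+∣p∣≡n (U ∪ V)) ⟨
      ∣ outside-both ∣ + ∣ U ∪ V ∣ + ∣ U ∩ V ∣    ≡⟨ +-assoc ∣ outside-both ∣ _ _ ⟩
      ∣ outside-both ∣ + (∣ U ∪ V ∣ + ∣ U ∩ V ∣)  ≡⟨ cong (∣ outside-both ∣ +_) (∣p∪q∣+∣p∩q∣≡∣p∣+∣q∣ U V) ⟩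
      ∣ outside-both ∣ + (∣ U ∣ + ∣ V ∣)          ≡⟨ cong (∣ outside-both ∣ +_) (cong₂ _+_ ∣U∣≡r ∣V∣≡r) ⟩
      ∣ outside-both ∣ + (r + r)                  ∎)
      where open ≤-Reasoning
    W = proj₁ (subset-of-size outside-both r r≤∣outside-both∣)
    W⊆outside-both = proj₁ (proj₂ (subset-of-size outside-both r r≤∣outside-both∣))
    ∣W∣≡r = proj₂ (proj₂ (subset-of-size outside-both r r≤∣outside-both∣))
    disjoint : ∀ {X} → (∀ {x} → x ∈ X → x ∈ U ∪ V) → Empty (W ∩ X)
    disjoint X⊆U∪V (x , x∈W∩X) =
      let x∈W , x∈X = x∈p∩q⁻ W _ x∈W∩X in x∈∁p⇒x∉p (W⊆outside-both x∈W) (X⊆U∪V x∈X)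

  closedNbhdsDisjoint⇒shared≡1 : 3 * r ≤ n + 2 → (u v : Vertex n r) →
                                  ClosedNbhdsDisjoint u v → shared u v ≡ 1
  closedNbhdsDisjoint⇒shared≡1 3r≤n+2 u v disjoint with shared u v in eq
  ... | 0 = ⊥-elim (disjoint u (inj₁ refl , inj₂ (∣p∣≡0⇒Empty _ eq)))
  ... | 1 = refl
  ... | suc (suc _) =
    let w , w-u , w-v = common-neighbour 3r≤n+2 u v (subst (2 ≤_) (sym eq) (s≤s (s≤s z≤n)))
    in ⊥-elim (disjoint w (inj₂ w-u , inj₂ w-v))

  shared≡1⇒closedNbhdsDisjoint : n + 2 ≤ 3 * r → (u v : Vertex n r) → u ≢ v →
                                  shared u v ≡ 1 → ClosedNbhdsDisjoint u v
  shared≡1⇒closedNbhdsDisjoint _ u v u≢v _ w (inj₁ refl , inj₁ u≡v) = u≢v u≡v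
  shared≡1⇒closedNbhdsDisjoint _ u v _ one w (inj₁ refl , inj₂ u-v) =
    0≢1+n (trans (sym (Empty⇒∣p∣≡0 u-v)) one)
  shared≡1⇒closedNbhdsDisjoint _ u v _ one w (inj₂ v-u , inj₁ refl) =
    0≢1+n (trans (sym (Empty⇒∣p∣≡0 v-u)) (shared-sym {u} {v} one))
  shared≡1⇒closedNbhdsDisjoint n+2≤3r u v _ one w (inj₂ w-u , inj₂ w-v) =
    contradiction (+-cancelˡ-≤ n 2 1 (≤-trans n+2≤3r bound)) λ { (s≤s ()) }
    where
    overlaps : overlapSum (map proj₁ (w ∷ u ∷ v ∷ [])) ≡ 1
    overlaps = trans (cong₂ (λ x y → x + (y + 0) + (shared u v + 0 + 0))
                            (Empty⇒∣p∣≡0 w-u) (Empty⇒∣p∣≡0 w-v))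
                     (cong (λ x → x + 0 + 0) one)
    bound : 3 * r ≤ n + 1
    bound = subst₂ _≤_ (sizeSum-vertices (w ∷ u ∷ v ∷ [])) (cong (n +_) overlaps)
                   (bonferroni (map proj₁ (w ∷ u ∷ v ∷ [])))

  SharePairwiseOne : List (Vertex n r) → Set
  SharePairwiseOne = AllPairs (λ u v → shared u v ≡ 1)

  twoPacking⇒sharePairwiseOne : 3 * r ≤ n + 2 → (S : List (Vertex n r)) → IsTwoPacking S →
                                SharePairwiseOne S
  twoPacking⇒sharePairwiseOne 3r≤n+2 S (unique , disjoint) =
    allPairs-map-∈ (λ {u} {v} u∈S v∈S u≢v →
                      closedNbhdsDisjoint⇒shared≡1 3r≤n+2 u v (disjoint u v u∈S v∈S u≢v))
                   unique

  sharePairwiseOne⇒twoPacking : n + 2 ≤ 3 * r → 2 ≤ r → (T : List (Vertex n r)) →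
                                SharePairwiseOne T → IsTwoPacking T
  sharePairwiseOne⇒twoPacking n+2≤3r 2≤r T pairwise =
    AllPairs.map distinct pairwise ,
    λ u v u∈T v∈T u≢v →
      shared≡1⇒closedNbhdsDisjoint n+2≤3r u v u≢v
        (allPairs-∈ {R = λ u v → shared u v ≡ 1} (λ {u} {v} → shared-sym {u} {v}) pairwise u∈T v∈T u≢v)
    where
    distinct : ∀ {u v} → shared u v ≡ 1 → u ≢ v
    distinct {u} one refl = <⇒≢ 2≤r (sym (trans (sym (shared-self u)) one))

  overlapSum-sharePairwiseOne : (vs : List (Vertex n r)) → SharePairwiseOne vs →
                                overlapSum (map proj₁ vs) ≡ length vs C 2
  overlapSum-sharePairwiseOne [] [] = refl
  overlapSum-sharePairwiseOne (v ∷ vs) (ones ∷ pairwise) = begin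
    sum (map (λ q → ∣ proj₁ v ∩ q ∣) (map proj₁ vs)) + overlapSum (map proj₁ vs)
      ≡⟨ cong₂ _+_ (sum-ones vs ones) (overlapSum-sharePairwiseOne vs pairwise) ⟩
    length vs + length vs C 2         ≡⟨ cong (_+ length vs C 2) (nC1≡n (length vs)) ⟨
    length vs C 1 + length vs C 2     ≡⟨ nCk+nC[k+1]≡[n+1]C[k+1] (length vs) 1 ⟩
    suc (length vs) C 2               ∎
    where
    open ≡-Reasoning
    sum-ones : ∀ ws → All (λ w → shared v w ≡ 1) ws →
               sum (map (λ q → ∣ proj₁ v ∩ q ∣) (map proj₁ ws)) ≡ length ws
    sum-ones [] [] = refl
    sum-ones (w ∷ ws) (one ∷ ones) = cong₂ _+_ one (sum-ones ws ones)

  sharePairwiseOne-bound : (vs : List (Vertex n r)) → SharePairwiseOne vs →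
                           length vs * r ≤ n + length vs C 2
  sharePairwiseOne-bound vs pairwise =
    subst₂ _≤_ (sizeSum-vertices vs) (cong (n +_) (overlapSum-sharePairwiseOne vs pairwise))
           (bonferroni (map proj₁ vs))

  at-most-three-sharing-one : n + 2 ≡ 3 * r → 5 ≤ r → (vs : List (Vertex n r)) →
                              SharePairwiseOne vs → length vs ≤ 3
  at-most-three-sharing-one _ _ [] _ = z≤n
  at-most-three-sharing-one _ _ (_ ∷ []) _ = s≤s z≤n
  at-most-three-sharing-one _ _ (_ ∷ _ ∷ []) _ = s≤s (s≤s z≤n)
  at-most-three-sharing-one _ _ (_ ∷ _ ∷ _ ∷ []) _ = ≤-refl
  at-most-three-sharing-one n+2≡3r 5≤r vs@(_ ∷ _ ∷ _ ∷ _ ∷ _) pairwise =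
    contradiction (+-cancelˡ-≤ (3 * r) 7 6 (begin
      3 * r + 7         ≤⟨ +-monoʳ-≤ (3 * r) (+-monoˡ-≤ 2 5≤r) ⟩
      3 * r + (r + 2)   ≡⟨ regroup r ⟩
      4 * r + 2         ≤⟨ +-monoˡ-≤ 2 (sharePairwiseOne-bound (take 4 vs) (take⁺ 4 pairwise)) ⟩
      n + 6 + 2         ≡⟨ +-assoc n 6 2 ⟩
      n + (2 + 6)       ≡⟨ +-assoc n 2 6 ⟨
      n + 2 + 6         ≡⟨ cong (_+ 6) n+2≡3r ⟩
      3 * r + 6         ∎)) λ { (s≤s (s≤s (s≤s (s≤s (s≤s (s≤s ())))))) }
    where
    open ≤-Reasoning
    regroup : ∀ r → 3 * r + (r + 2) ≡ 4 * r + 2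
    regroup = solve-∀

  maxTwoPacking-shape : n + 2 ≡ 3 * r → 5 ≤ r →
                        (T : List (Vertex n r)) → IsTwoPacking T → length T ≡ 3 →
                        (S : List (Vertex n r)) → IsMaxTwoPacking S →
                        length S ≡ 3 × SharePairwiseOne S
  maxTwoPacking-shape n+2≡3r 5≤r T T-packing ∣T∣≡3 S (S-packing , maximum) =
    ≤-antisym (at-most-three-sharing-one n+2≡3r 5≤r S pairwise)
              (subst (_≤ length S) ∣T∣≡3 (maximum T T-packing)) ,
    pairwise
    where
    pairwise = twoPacking⇒sharePairwiseOne (≤-reflexive (sym n+2≡3r)) S S-packing

-- Automorphisms induced by permutations of [n]

module _ {n r : ℕ} where

  vertex-≡ : {u v : Vertex n r} → proj₁ u ≡ proj₁ v → u ≡ v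
  vertex-≡ {_ , ∣p∣≡r} {_ , ∣p∣≡r′} refl = cong (_ ,_) (≡-irrelevant ∣p∣≡r ∣p∣≡r′)

  permuteVertex : Permutation n n → Vertex n r → Vertex n r
  permuteVertex π (p , ∣p∣≡r) = permuteSubset π p , trans (∣permuteSubset∣ π p) ∣p∣≡r

  permuteVertex-flip : ∀ π u → permuteVertex (Perm.flip π) (permuteVertex π u) ≡ u
  permuteVertex-flip π (p , _) = vertex-≡ (permuteSubset-flip π p)

  permuteVertex-preserves-Adj : ∀ π u v → Adj u v → Adj (permuteVertex π u) (permuteVertex π v)
  permuteVertex-preserves-Adj π (p , _) (q , _) p∩q-empty = ∣p∣≡0⇒Empty _ (begin
    ∣ permuteSubset π p ∩ permuteSubset π q ∣ ≡⟨ cong ∣_∣ (permuteSubset-∩ π p q) ⟨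
    ∣ permuteSubset π (p ∩ q) ∣             ≡⟨ ∣permuteSubset∣ π (p ∩ q) ⟩
    ∣ p ∩ q ∣                               ≡⟨ Empty⇒∣p∣≡0 p∩q-empty ⟩
    0                                       ∎)
    where open ≡-Reasoning

  permuteVertex-automorphism : ∀ π → IsAutomorphism (permuteVertex π)
  permuteVertex-automorphism π = bijective , λ u v → mk⇔ (permuteVertex-preserves-Adj π u v) (reflects u v)
    where
    reflects : ∀ u v → Adj (permuteVertex π u) (permuteVertex π v) → Adj u v
    reflects u v adj = subst₂ (Adj {n} {r}) (permuteVertex-flip π u) (permuteVertex-flip π v)
                              (permuteVertex-preserves-Adj (Perm.flip π)
                                                           (permuteVertex π u) (permuteVertex π v) adj)
    bijective = inverseᵇ⇒bijective
      ( strictlyInverseˡ⇒inverseˡ {f⁻¹ = permuteVertex (Perm.flip π)} (permuteVertex π)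
                                  (permuteVertex-flip (Perm.flip π))
      , strictlyInverseʳ⇒inverseʳ {f⁻¹ = permuteVertex (Perm.flip π)} (permuteVertex π)
                                  (permuteVertex-flip π))

module Colouring {C : Set} (_≟_ : DecidableEquality C) where

  classSize : ∀ {n} → (Fin n → C) → C → ℕ
  classSize col c = count (λ i → does (col i ≟ c))

  matching-permutation : ∀ {n} (col col′ : Fin n → C) → (∀ c → classSize col c ≡ classSize col′ c) →
                         Σ[ π ∈ Permutation n n ] (∀ i → col (π ⟨$⟩ʳ i) ≡ col′ i)
  matching-permutation {zero} col col′ _ = Perm.id , λ ()
  matching-permutation {suc n} col col′ same = Perm.insert zero i₀ π , matches
    where
    c₀ = col′ zero
    c₀-occurs : 0 < classSize col′ c₀
    c₀-occurs = subst (λ b → 0 < bit b + classSize (col′ ∘ suc) c₀) (sym (dec-true (c₀ ≟ c₀) refl)) (s≤s z≤n)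
    position = count>0⇒∃ (λ i → does (col i ≟ c₀)) (subst (0 <_) (sym (same c₀)) c₀-occurs)
    i₀ = proj₁ position
    col-i₀ : col i₀ ≡ c₀
    col-i₀ with col i₀ ≟ c₀ | proj₂ position
    ... | yes col-i₀≡c₀ | _ = col-i₀≡c₀
    same-rest : ∀ c → classSize (col ∘ punchIn i₀) c ≡ classSize (col′ ∘ suc) c
    same-rest c = +-cancelˡ-≡ (bit (does (c₀ ≟ c))) _ _ (begin
      bit (does (c₀ ≟ c)) + classSize (col ∘ punchIn i₀) c
        ≡⟨ cong (λ x → bit (does (x ≟ c)) + classSize (col ∘ punchIn i₀) c) col-i₀ ⟨
      bit (does (col i₀ ≟ c)) + classSize (col ∘ punchIn i₀) c
        ≡⟨ sum-remove {i = i₀} (λ i → bit (does (col i ≟ c))) ⟨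
      classSize col c
        ≡⟨ same c ⟩
      classSize col′ c
        ∎)
      where open ≡-Reasoning
    rest = matching-permutation (col ∘ punchIn i₀) (col′ ∘ suc) same-rest
    π = proj₁ rest
    matches : ∀ i → col (Perm.insert zero i₀ π ⟨$⟩ʳ i) ≡ col′ i
    matches zero = col-i₀
    matches (suc i) = trans (cong col (Perm.insert-punchIn zero i₀ π i)) (proj₂ rest i)

-- Venn diagrams of three sets

Region : Set
Region = Bool × Bool × Bool

_≟ᴿ_ : DecidableEquality Region
_≟ᴿ_ = ≡-dec Bool._≟_ (≡-dec Bool._≟_ Bool._≟_)

open Colouring _≟ᴿ_

inA inB inC : Region → Bool
inA = proj₁
inB = proj₁ ∘ proj₂
inC = proj₂ ∘ proj₂

venn : ∀ {n} → Subset n → Subset n → Subset n → Fin n → Region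
venn X Y Z i = lookup X i , lookup Y i , lookup Z i

regions : List Region
regions = (true , true , true) ∷ (true , true , false) ∷ (true , false , true) ∷ (false , true , true) ∷
          (true , false , false) ∷ (false , true , false) ∷ (false , false , true) ∷ (false , false , false) ∷ []

regionSum : (Region → Bool) → (Region → ℕ) → ℕ
regionSum p a = sum (map (λ c → if p c then a c else 0) regions)

value-as-regionSum : ∀ (w : Region → ℕ) x → w x ≡ sum (map (λ c → bit (does (x ≟ᴿ c)) * w c) regions)
value-as-regionSum w x@(true , true , true) = sym (trans (+-identityʳ _) (+-identityʳ (w x)))
value-as-regionSum w x@(true , true , false) = sym (trans (+-identityʳ _) (+-identityʳ (w x)))
value-as-regionSum w x@(true , false , true) = sym (trans (+-identityʳ _) (+-identityʳ (w x)))
value-as-regionSum w x@(false , true , true) = sym (trans (+-identityʳ _) (+-identityʳ (w x)))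
value-as-regionSum w x@(true , false , false) = sym (trans (+-identityʳ _) (+-identityʳ (w x)))
value-as-regionSum w x@(false , true , false) = sym (trans (+-identityʳ _) (+-identityʳ (w x)))
value-as-regionSum w x@(false , false , true) = sym (trans (+-identityʳ _) (+-identityʳ (w x)))
value-as-regionSum w x@(false , false , false) = sym (trans (+-identityʳ _) (+-identityʳ (w x)))

count-by-region : ∀ {n} (col : Fin n → Region) (p : Region → Bool) →
                  count (p ∘ col) ≡ regionSum p (classSize col)
count-by-region col p = begin
  ∑ (λ i → bit (p (col i)))
    ≡⟨ sum-cong-≗ (λ i → value-as-regionSum (bit ∘ p) (col i)) ⟩
  ∑ (λ i → sum (map (λ c → bit (does (col i ≟ᴿ c)) * bit (p c)) regions))
    ≡⟨ ∑-sum-comm (λ c i → bit (does (col i ≟ᴿ c)) * bit (p c)) regions ⟨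
  sum (map (λ c → ∑ (λ i → bit (does (col i ≟ᴿ c)) * bit (p c))) regions)
    ≡⟨ cong sum (map-cong (λ c → trans (sym (*-distribʳ-sum (bit (p c)) (λ i → bit (does (col i ≟ᴿ c)))))
                                       (+-*-bit 0 (classSize col c) (p c))) regions) ⟩
  regionSum p (classSize col) ∎
  where open ≡-Reasoning

venn-automorphism : ∀ {n r} (u v w : Vertex n r) (X Y Z : Subset n) →
  (∀ c → classSize (venn (proj₁ u) (proj₁ v) (proj₁ w)) c ≡ classSize (venn X Y Z) c) →
  Σ[ φ ∈ (Vertex n r → Vertex n r) ]
    IsAutomorphism φ × map (λ x → proj₁ (φ x)) (u ∷ v ∷ w ∷ []) ≡ X ∷ Y ∷ Z ∷ []
venn-automorphism u v w X Y Z same =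
  permuteVertex π , permuteVertex-automorphism π ,
  cong₂ _∷_ (subset-ext λ i → trans (lookup-permuteSubset π (proj₁ u) i) (cong inA (matches i)))
  (cong₂ _∷_ (subset-ext λ i → trans (lookup-permuteSubset π (proj₁ v) i) (cong inB (matches i)))
  (cong₂ _∷_ (subset-ext λ i → trans (lookup-permuteSubset π (proj₁ w) i) (cong inC (matches i))) refl))
  where
  matching = matching-permutation (venn (proj₁ u) (proj₁ v) (proj₁ w)) (venn X Y Z) same
  π = proj₁ matching
  matches = proj₂ matching

-- Layouts: three sets built from consecutive blocks

≤ᵇ-true : ∀ {m n} → m ≤ n → (m ≤ᵇ n) ≡ true
≤ᵇ-true m≤n = Equivalence.to T-≡ (≤⇒≤ᵇ m≤n)

≤ᵇ-false : ∀ {m n} → n < m → (m ≤ᵇ n) ≡ false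
≤ᵇ-false {m} {n} n<m with m ≤ᵇ n in eq
... | true = contradiction (≤ᵇ⇒≤ m n (subst T (sym eq) _)) (<⇒≱ n<m)
... | false = refl

≡ᵇ-false : ∀ {m n} → m ≢ n → (m ≡ᵇ n) ≡ false
≡ᵇ-false {m} {n} m≢n with m ≡ᵇ n in eq
... | true = contradiction (≡ᵇ⇒≡ m n (subst T (sym eq) _)) m≢n
... | false = refl

≤ᵇ≡<ᵇsuc : ∀ x e → (x ≤ᵇ e) ≡ (x <ᵇ suc e)
≤ᵇ≡<ᵇsuc zero e = refl
≤ᵇ≡<ᵇsuc (suc x) e = refl

blockStart : ℕ → List ℕ → ℕ → ℕ
blockStart o ls zero = o
blockStart o [] (suc u) = o
blockStart o (l ∷ ls) (suc u) = blockStart (o + l) ls u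

o≤blockStart : ∀ o ls u → o ≤ blockStart o ls u
o≤blockStart o ls zero = ≤-refl
o≤blockStart o [] (suc u) = ≤-refl
o≤blockStart o (l ∷ ls) (suc u) = ≤-trans (m≤m+n o l) (o≤blockStart (o + l) ls u)

blockStart-mono : ∀ o ls {u v} → u ≤ v → blockStart o ls u ≤ blockStart o ls v
blockStart-mono o ls {v = v} z≤n = o≤blockStart o ls v
blockStart-mono o [] (s≤s _) = ≤-refl
blockStart-mono o (l ∷ ls) (s≤s u≤v) = blockStart-mono (o + l) ls u≤v

inBlock : List ℕ → ℕ → ℕ → Bool
inBlock ls u x = (blockStart 0 ls u ≤ᵇ x) ∧ (x <ᵇ blockStart 0 ls (suc u))

inBlocks : List ℕ → List ℕ → ℕ → Bool
inBlocks ls [] x = false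
inBlocks ls (u ∷ []) x = inBlock ls u x
inBlocks ls (u ∷ us@(_ ∷ _)) x = inBlock ls u x ∨ inBlocks ls us x

inR≡inBlock : ∀ ls u {s e} → s ≡ blockStart 0 ls u → suc e ≡ blockStart 0 ls (suc u) →
              ∀ x → inR s e x ≡ inBlock ls u x
inR≡inBlock ls u refl suc-e≡end x =
  cong ((blockStart 0 ls u ≤ᵇ x) ∧_) (trans (≤ᵇ≡<ᵇsuc x _) (cong (x <ᵇ_) suc-e≡end))

module _ (ls : List ℕ) {v x : ℕ} (start≤x : blockStart 0 ls v ≤ x) (x<end : x < blockStart 0 ls (suc v)) where

  inBlock-on : ∀ u → inBlock ls u x ≡ (u ≡ᵇ v)
  inBlock-on u with <-cmp u v
  ... | tri< u<v u≢v _ = begin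
    (blockStart 0 ls u ≤ᵇ x) ∧ (x <ᵇ blockStart 0 ls (suc u))
      ≡⟨ cong ((blockStart 0 ls u ≤ᵇ x) ∧_) (≤ᵇ-false (s≤s (≤-trans (blockStart-mono 0 ls u<v) start≤x))) ⟩
    (blockStart 0 ls u ≤ᵇ x) ∧ false  ≡⟨ ∧-zeroʳ (blockStart 0 ls u ≤ᵇ x) ⟩
    false                             ≡⟨ ≡ᵇ-false u≢v ⟨
    (u ≡ᵇ v)                          ∎
    where open ≡-Reasoning
  ... | tri≈ _ refl _ =
    trans (cong₂ _∧_ (≤ᵇ-true start≤x) (≤ᵇ-true x<end)) (sym (Equivalence.to T-≡ (≡⇒≡ᵇ u u refl)))
  ... | tri> _ u≢v v<u =
    trans (cong (_∧ (x <ᵇ blockStart 0 ls (suc u))) (≤ᵇ-false (<-≤-trans x<end (blockStart-mono 0 ls v<u))))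
          (sym (≡ᵇ-false u≢v))

  inBlocks-on : ∀ us → inBlocks ls us x ≡ any (_≡ᵇ v) us
  inBlocks-on [] = refl
  inBlocks-on (u ∷ []) = trans (inBlock-on u) (sym (∨-identityʳ _))
  inBlocks-on (u ∷ us@(_ ∷ _)) = cong₂ _∨_ (inBlock-on u) (inBlocks-on us)

module _ {C : Set} (p : C → Bool) where

  blockCount : (ℕ → C) → List ℕ → ℕ → ℕ
  blockCount col [] acc = acc
  blockCount col (l ∷ ls) acc = blockCount (col ∘ suc) ls (if p (col 0) then acc + l else acc)

  count-blocks : ∀ ls o acc (D : ℕ → C) (col : ℕ → C) →
                 (∀ v x → blockStart o ls v ≤ x → x < blockStart o ls (suc v) → D x ≡ col v) →
                 acc + ∑ {sum ls} (λ i → bit (p (D (o + toℕ i)))) ≡ blockCount col ls acc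
  count-blocks [] o acc D col _ = +-identityʳ acc
  count-blocks (l ∷ ls) o acc D col on-block = begin
    acc + ∑ {l + sum ls} (λ i → f (toℕ i))
      ≡⟨ cong (acc +_) (∑-split l (sum ls) f) ⟩
    acc + (∑ {l} (λ i → f (toℕ i)) + ∑ {sum ls} (λ i → f (l + toℕ i)))
      ≡⟨ +-assoc acc _ _ ⟨
    acc + ∑ {l} (λ i → f (toℕ i)) + ∑ {sum ls} (λ i → f (l + toℕ i))
      ≡⟨ cong₂ _+_ first-block (sum-cong-≗ {sum ls} λ i → cong (bit ∘ p ∘ D) (sym (+-assoc o l (toℕ i)))) ⟩
    (if p (col 0) then acc + l else acc) + ∑ {sum ls} (λ i → bit (p (D (o + l + toℕ i))))
      ≡⟨ count-blocks ls (o + l) _ D (col ∘ suc) (λ v → on-block (suc v)) ⟩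
    blockCount (col ∘ suc) ls (if p (col 0) then acc + l else acc)
      ∎
    where
    open ≡-Reasoning
    f : ℕ → ℕ
    f x = bit (p (D (o + x)))
    first-block : acc + ∑ {l} (λ i → f (toℕ i)) ≡ (if p (col 0) then acc + l else acc)
    first-block = trans (cong (acc +_) (trans (sum-cong-≗ λ i →
                          cong (bit ∘ p) (on-block 0 (o + toℕ i) (m≤m+n o _) (+-monoʳ-< o (toℕ<n i))))
                        (∑-const l _)))
                        (+-*-bit acc l (p (col 0)))

-- Consecutive blocks of the given lengths partition [0, sum lengths); set A is the union of the
-- blocks whose indices are listed in blocksA, and similarly for B and C.
record Layout : Set where
  constructor layout
  field
    lengths blocksA blocksB blocksC : List ℕ

module _ (L : Layout) where
  open Layout L

  layoutRegion : ℕ → Region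
  layoutRegion v = any (_≡ᵇ v) blocksA , any (_≡ᵇ v) blocksB , any (_≡ᵇ v) blocksC

  layoutColouring : ℕ → Region
  layoutColouring x = inBlocks lengths blocksA x , inBlocks lengths blocksB x , inBlocks lengths blocksC x

  layoutCount : (Region → Bool) → ℕ
  layoutCount p = blockCount p layoutRegion lengths 0

  count-layoutColouring : ∀ p → ∑ {sum lengths} (λ i → bit (p (layoutColouring (toℕ i)))) ≡ layoutCount p
  count-layoutColouring p = count-blocks p lengths 0 0 layoutColouring layoutRegion λ v x start≤x x<end →
    cong₂ _,_ (inBlocks-on lengths start≤x x<end blocksA)
              (cong₂ _,_ (inBlocks-on lengths start≤x x<end blocksB) (inBlocks-on lengths start≤x x<end blocksC))

layoutSizes : Layout → Region → ℕ
layoutSizes L c = layoutCount L (λ c′ → does (c′ ≟ᴿ c))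

colouringVenn : ∀ n → (ℕ → Region) → Fin n → Region
colouringVenn n D = venn (fromPred n (inA ∘ D)) (fromPred n (inB ∘ D)) (fromPred n (inC ∘ D))

count-colouringVenn : ∀ {n} (L : Layout) (D : ℕ → Region) → (∀ x → D x ≡ layoutColouring L x) →
                      n ≡ sum (Layout.lengths L) → ∀ p → count (p ∘ colouringVenn n D) ≡ layoutCount L p
count-colouringVenn {n} L D agrees n≡length p = begin
  ∑ (λ i → bit (p (colouringVenn n D i)))
    ≡⟨ sum-cong-≗ (λ i → cong (bit ∘ p) (trans (colouringVenn≡ i) (agrees (toℕ i)))) ⟩
  ∑ {n} (λ i → bit (p (layoutColouring L (toℕ i))))
    ≡⟨ cong (λ k → ∑ {k} (λ i → bit (p (layoutColouring L (toℕ i))))) n≡length ⟩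
  ∑ {sum (Layout.lengths L)} (λ i → bit (p (layoutColouring L (toℕ i))))
    ≡⟨ count-layoutColouring L p ⟩
  layoutCount L p ∎
  where
  open ≡-Reasoning
  colouringVenn≡ : ∀ i → colouringVenn n D i ≡ D (toℕ i)
  colouringVenn≡ i = cong₂ _,_ (lookup∘tabulate _ i) (cong₂ _,_ (lookup∘tabulate _ i) (lookup∘tabulate _ i))

-- The layouts of config2 and config1 for r = 2 + j.
pencil triangle : ℕ → Layout
pencil j = layout (1 ∷ suc j ∷ suc j ∷ suc j ∷ []) (0 ∷ 1 ∷ []) (0 ∷ 2 ∷ []) (0 ∷ 3 ∷ [])
triangle j = layout (1 ∷ 1 ∷ 1 ∷ j ∷ j ∷ j ∷ 1 ∷ []) (0 ∷ 1 ∷ 3 ∷ []) (0 ∷ 2 ∷ 4 ∷ []) (1 ∷ 2 ∷ 5 ∷ [])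

venn-arith : ∀ j abc ab ac bc a b c none →
  abc + ab ≡ 1 → abc + ac ≡ 1 → abc + bc ≡ 1 →
  abc + (ab + (ac + a)) ≡ 2 + j → abc + (ab + (bc + b)) ≡ 2 + j → abc + (ac + (bc + c)) ≡ 2 + j →
  abc + (ab + (ac + (bc + (a + (b + (c + none)))))) + 2 ≡ 3 * (2 + j) →
  (abc ≡ 1 × ab ≡ 0 × ac ≡ 0 × bc ≡ 0 × a ≡ suc j × b ≡ suc j × c ≡ suc j × none ≡ 0) ⊎
  (abc ≡ 0 × ab ≡ 1 × ac ≡ 1 × bc ≡ 1 × a ≡ j × b ≡ j × c ≡ j × none ≡ 1)
venn-arith j 0 .1 .1 .1 .j .j .j none refl refl refl refl refl refl total =
  inj₂ (refl , refl , refl , refl , refl , refl , refl ,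
        +-cancelˡ-≡ (5 + 3 * j) none 1 (trans (lhs j none) (trans total (rhs j))))
  where
  lhs : ∀ j z → 5 + 3 * j + z ≡ 0 + (1 + (1 + (1 + (j + (j + (j + z)))))) + 2
  lhs = solve-∀
  rhs : ∀ j → 3 * (2 + j) ≡ 5 + 3 * j + 1
  rhs = solve-∀
venn-arith j 1 .0 .0 .0 .(suc j) .(suc j) .(suc j) none refl refl refl refl refl refl total =
  inj₁ (refl , refl , refl , refl , refl , refl , refl ,
        +-cancelˡ-≡ (6 + 3 * j) none 0 (trans (lhs j none) (trans total (rhs j))))
  where
  lhs : ∀ j z → 6 + 3 * j + z ≡ 1 + (0 + (0 + (0 + (suc j + (suc j + (suc j + z)))))) + 2
  lhs = solve-∀
  rhs : ∀ j → 3 * (2 + j) ≡ 6 + 3 * j + 0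
  rhs = solve-∀

venn-classification : ∀ j n (size : Region → ℕ) → n + 2 ≡ 3 * (2 + j) →
  regionSum inA size ≡ 2 + j → regionSum inB size ≡ 2 + j → regionSum inC size ≡ 2 + j →
  regionSum (λ c → inA c ∧ inB c) size ≡ 1 → regionSum (λ c → inA c ∧ inC c) size ≡ 1 →
  regionSum (λ c → inB c ∧ inC c) size ≡ 1 → regionSum (λ _ → true) size ≡ n →
  (∀ c → size c ≡ layoutSizes (pencil j) c) ⊎ (∀ c → size c ≡ layoutSizes (triangle j) c)
venn-classification j n size n+2≡3r ∣A∣ ∣B∣ ∣C∣ ∣A∩B∣ ∣A∩C∣ ∣B∩C∣ total
  -- each regionSum unfolds to a right-nested sum whose last summand carries a trailing + 0
  with venn-arith j abc ab ac bc a b c none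
         (trans (cong (abc +_) (sym (+-identityʳ ab))) ∣A∩B∣)
         (trans (cong (abc +_) (sym (+-identityʳ ac))) ∣A∩C∣)
         (trans (cong (abc +_) (sym (+-identityʳ bc))) ∣B∩C∣)
         (trans (cong (λ x → abc + (ab + (ac + x))) (sym (+-identityʳ a))) ∣A∣)
         (trans (cong (λ x → abc + (ab + (bc + x))) (sym (+-identityʳ b))) ∣B∣)
         (trans (cong (λ x → abc + (ac + (bc + x))) (sym (+-identityʳ c))) ∣C∣)
         (trans (cong (_+ 2) (trans (cong (λ x → abc + (ab + (ac + (bc + (a + (b + (c + x)))))))
                                          (sym (+-identityʳ none)))
                                    total))
                n+2≡3r)
  where
  abc = size (true , true , true)
  ab = size (true , true , false)
  ac = size (true , false , true)
  bc = size (false , true , true)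
  a = size (true , false , false)
  b = size (false , true , false)
  c = size (false , false , true)
  none = size (false , false , false)
... | inj₁ (abc≡1 , ab≡0 , ac≡0 , bc≡0 , a≡ , b≡ , c≡ , none≡0) = inj₁ λ where
  (true , true , true) → abc≡1
  (true , true , false) → ab≡0
  (true , false , true) → ac≡0
  (false , true , true) → bc≡0
  (true , false , false) → a≡
  (false , true , false) → b≡
  (false , false , true) → c≡
  (false , false , false) → none≡0
... | inj₂ (abc≡0 , ab≡1 , ac≡1 , bc≡1 , a≡ , b≡ , c≡ , none≡1) = inj₂ λ where
  (true , true , true) → abc≡0
  (true , true , false) → ab≡1
  (true , false , true) → ac≡1
  (false , true , true) → bc≡1
  (true , false , false) → a≡
  (false , true , false) → b≡
  (false , false , true) → c≡
  (false , false , false) → none≡1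

-- The two configurations

∸-≡ : ∀ {m n k} → m ≡ n + k → m ∸ k ≡ n
∸-≡ {n = n} {k} refl = m+n∸n≡m n k

≡⇒SameSet : ∀ {n} {xs ys : List (Subset n)} → xs ≡ ys → SameSet xs ys
≡⇒SameSet refl _ = mk⇔ id id

module Configurations (j : ℕ) where

  r n : ℕ
  r = 2 + j
  n = 3 * r ∸ 2

  n+2≡3r : n + 2 ≡ 3 * r
  n+2≡3r = m∸n+n≡m (s≤s (s≤s z≤n))

  pencilColouring triangleColouring : ℕ → Region
  pencilColouring x = is 1 x ∨ iv 2 r x , is 1 x ∨ iv (r + 1) (2 * r ∸ 1) x , is 1 x ∨ iv (2 * r) (3 * r ∸ 2) x
  triangleColouring x = is 1 x ∨ is 2 x ∨ iv 4 (r + 1) x , is 1 x ∨ is 3 x ∨ iv (r + 2) (2 * r ∸ 1) x ,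
                        is 2 x ∨ is 3 x ∨ iv (2 * r) (3 * r ∸ 3) x

  private
    2r∸1≡pencil : 2 * r ∸ 1 ≡ 2 + j + suc j
    2r∸1≡pencil = ∸-≡ (eq j)
      where
      eq : ∀ j → 2 * (2 + j) ≡ 2 + j + suc j + 1
      eq = solve-∀

    3r∸2≡pencil : 3 * r ∸ 2 ≡ 2 + j + suc j + suc j
    3r∸2≡pencil = ∸-≡ (eq j)
      where
      eq : ∀ j → 3 * (2 + j) ≡ 2 + j + suc j + suc j + 2
      eq = solve-∀

    2r∸1≡triangle : 2 * r ∸ 1 ≡ 3 + j + j
    2r∸1≡triangle = ∸-≡ (eq j)
      where
      eq : ∀ j → 2 * (2 + j) ≡ 3 + j + j + 1
      eq = solve-∀

    3r∸3≡triangle : 3 * r ∸ 3 ≡ 3 + j + j + j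
    3r∸3≡triangle = ∸-≡ (eq j)
      where
      eq : ∀ j → 3 * (2 + j) ≡ 3 + j + j + j + 3
      eq = solve-∀

    n≡length-pencil : n ≡ sum (Layout.lengths (pencil j))
    n≡length-pencil = ∸-≡ (eq j)
      where
      eq : ∀ j → 3 * (2 + j) ≡ 1 + (suc j + (suc j + (suc j + 0))) + 2
      eq = solve-∀

    n≡length-triangle : n ≡ sum (Layout.lengths (triangle j))
    n≡length-triangle = ∸-≡ (eq j)
      where
      eq : ∀ j → 3 * (2 + j) ≡ 1 + (1 + (1 + (j + (j + (j + (1 + 0)))))) + 2
      eq = solve-∀

    -- Every interval of a configuration is exactly one block of its layout.
    pencil-agrees : ∀ x → pencilColouring x ≡ layoutColouring (pencil j) x
    pencil-agrees x =
      cong₂ _,_ (cong₂ _∨_ (block 0 refl refl) (block 1 refl refl))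
      (cong₂ _,_ (cong₂ _∨_ (block 0 refl refl) (block 2 (cong suc (+-comm j 1)) 2r∸1≡pencil))
                 (cong₂ _∨_ (block 0 refl refl) (block 3 2r∸1≡pencil (cong (λ y → suc (y ∸ 1)) 3r∸2≡pencil))))
      where
      block : ∀ u {s e} → s ≡ blockStart 0 (Layout.lengths (pencil j)) u →
              suc e ≡ blockStart 0 (Layout.lengths (pencil j)) (suc u) →
              inR s e x ≡ inBlock (Layout.lengths (pencil j)) u x
      block u s≡start e≡end = inR≡inBlock (Layout.lengths (pencil j)) u s≡start e≡end x

    triangle-agrees : ∀ x → triangleColouring x ≡ layoutColouring (triangle j) x
    triangle-agrees x =
      cong₂ _,_ (cong₂ _∨_ (block 0 refl refl)
                           (cong₂ _∨_ (block 1 refl refl) (block 3 refl (cong (2 +_) (+-comm j 1)))))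
      (cong₂ _,_ (cong₂ _∨_ (block 0 refl refl)
                            (cong₂ _∨_ (block 2 refl refl) (block 4 (cong suc (+-comm j 2)) 2r∸1≡triangle)))
                 (cong₂ _∨_ (block 1 refl refl)
                            (cong₂ _∨_ (block 2 refl refl)
                                       (block 5 2r∸1≡triangle (cong (λ y → suc (y ∸ 1)) 3r∸3≡triangle)))))
      where
      block : ∀ u {s e} → s ≡ blockStart 0 (Layout.lengths (triangle j)) u →
              suc e ≡ blockStart 0 (Layout.lengths (triangle j)) (suc u) →
              inR s e x ≡ inBlock (Layout.lengths (triangle j)) u x
      block u s≡start e≡end = inR≡inBlock (Layout.lengths (triangle j)) u s≡start e≡end x

  pencil-count : ∀ p → count (p ∘ colouringVenn n pencilColouring) ≡ layoutCount (pencil j) p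
  pencil-count = count-colouringVenn (pencil j) pencilColouring pencil-agrees n≡length-pencil

  triangle-count : ∀ p → count (p ∘ colouringVenn n triangleColouring) ≡ layoutCount (triangle j) p
  triangle-count = count-colouringVenn (triangle j) triangleColouring triangle-agrees n≡length-triangle

  pencilA pencilB pencilC : Subset n
  pencilA = fromPred n (inA ∘ pencilColouring)
  pencilB = fromPred n (inB ∘ pencilColouring)
  pencilC = fromPred n (inC ∘ pencilColouring)

  pencilPacking : List (Vertex n r)
  pencilPacking = (pencilA , trans (∣p∣≡count pencilA) (pencil-count inA)) ∷
                  (pencilB , trans (∣p∣≡count pencilB) (pencil-count inB)) ∷
                  (pencilC , trans (∣p∣≡count pencilC) (pencil-count inC)) ∷ []

  pencilPacking-isTwoPacking : IsTwoPacking pencilPacking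
  pencilPacking-isTwoPacking = sharePairwiseOne⇒twoPacking (≤-reflexive n+2≡3r) (s≤s (s≤s z≤n)) pencilPacking
    ((trans (∣p∩q∣≡count pencilA pencilB) (pencil-count (λ c → inA c ∧ inB c)) ∷
      trans (∣p∩q∣≡count pencilA pencilC) (pencil-count (λ c → inA c ∧ inC c)) ∷ []) ∷
     (trans (∣p∩q∣≡count pencilB pencilC) (pencil-count (λ c → inB c ∧ inC c)) ∷ []) ∷ [] ∷ [])

  venn-sizes-classification : (a b c : Vertex n r) →
    shared a b ≡ 1 → shared a c ≡ 1 → shared b c ≡ 1 →
    (∀ x → classSize (venn (proj₁ a) (proj₁ b) (proj₁ c)) x ≡ layoutSizes (pencil j) x) ⊎
    (∀ x → classSize (venn (proj₁ a) (proj₁ b) (proj₁ c)) x ≡ layoutSizes (triangle j) x)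
  venn-sizes-classification (A , ∣A∣≡r) (B , ∣B∣≡r) (C , ∣C∣≡r) ab ac bc =
    venn-classification j n (classSize (venn A B C)) n+2≡3r
      (from-count inA (trans (sym (∣p∣≡count A)) ∣A∣≡r))
      (from-count inB (trans (sym (∣p∣≡count B)) ∣B∣≡r))
      (from-count inC (trans (sym (∣p∣≡count C)) ∣C∣≡r))
      (from-count (λ x → inA x ∧ inB x) (trans (sym (∣p∩q∣≡count A B)) ab))
      (from-count (λ x → inA x ∧ inC x) (trans (sym (∣p∩q∣≡count A C)) ac))
      (from-count (λ x → inB x ∧ inC x) (trans (sym (∣p∩q∣≡count B C)) bc))
      (from-count (λ _ → true) (trans (∑-const n 1) (*-identityʳ n)))
    where
    from-count : ∀ p {m} → count (p ∘ venn A B C) ≡ m → regionSum p (classSize (venn A B C)) ≡ m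
    from-count p = trans (sym (count-by-region (venn A B C) p))

  ConfigurationUpToAutomorphism : List (Vertex n r) → Set
  ConfigurationUpToAutomorphism S = Σ (Vertex n r → Vertex n r) (λ φ →
    IsAutomorphism φ ×
    (SameSet (map (λ v → proj₁ (φ v)) S) (config1 r) ⊎ SameSet (map (λ v → proj₁ (φ v)) S) (config2 r)))

  sharing-triple-is-configuration : (S : List (Vertex n r)) → length S ≡ 3 → SharePairwiseOne S →
                                    ConfigurationUpToAutomorphism S
  sharing-triple-is-configuration (a ∷ b ∷ c ∷ []) _ ((ab ∷ ac ∷ []) ∷ (bc ∷ []) ∷ [] ∷ [])
    with venn-sizes-classification a b c ab ac bc
  ... | inj₁ pencil-sizes =
    let φ , φ-automorphism , moved = venn-automorphism a b c _ _ _ λ x →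
          trans (pencil-sizes x) (sym (pencil-count (λ y → does (y ≟ᴿ x))))
    in φ , φ-automorphism , inj₂ (≡⇒SameSet moved)
  ... | inj₂ triangle-sizes =
    let φ , φ-automorphism , moved = venn-automorphism a b c _ _ _ λ x →
          trans (triangle-sizes x) (sym (triangle-count (λ y → does (y ≟ᴿ x))))
    in φ , φ-automorphism , inj₁ (≡⇒SameSet moved)

corollary5 : (r : ℕ) → 5 ≤ r →
    (S : List (Vertex (3 * r ∸ 2) r)) → IsMaxTwoPacking S →
    Σ (Vertex (3 * r ∸ 2) r → Vertex (3 * r ∸ 2) r) (λ φ →
      IsAutomorphism φ ×
      (SameSet (map (λ v → proj₁ (φ v)) S) (config1 r) ⊎
       SameSet (map (λ v → proj₁ (φ v)) S) (config2 r)))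
corollary5 (suc (suc j)) 5≤r@(s≤s (s≤s _)) S S-max =
  let ∣S∣≡3 , pairwise = maxTwoPacking-shape n+2≡3r 5≤r pencilPacking pencilPacking-isTwoPacking refl S S-max
  in sharing-triple-is-configuration S ∣S∣≡3 pairwise
  where open Configurations j
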